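{- Let $M=(E,\mathcal{I})$ be a unique expansion matroid on a finite set $E$ with $r(M)>0$, and let $B\subseteq E$. Then $B\in\mathcal{B}(M)$ if and only if $B\subseteq\bigcup\mathcal{B}(M)$ and $|B\cap D|=1$ for every $D\in F(M)$.
   Context: $\mathcal{B}(M)$ is the family of bases, $r(M)$ the common cardinality of bases, $r(X)$ the rank of $X\subseteq E$. $s(M)=\{A\in\mathcal{I}: |A|=r(M)-1\}$. For $X\subseteq E$, $K_M(X)=\{a\in E: r(X\cup\{a\})=r(X)+1\}$; $F(M)=\{K_M(X): X\in s(M)\}$. $M$ is a unique expansion matroid if for every $B\in\mathcal{B}(M)$ and every $A\in s(M)$, whenever $e_1,e_2\in B$ satisfy $A\cup\{e_1\},A\cup\{e_2\}\in\mathcal{B}(M)$, then $e_1=e_2$. -}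

module Defs where

open import Data.Nat using (ℕ; suc; _<_; _≤_)
open import Data.Fin using (Fin)
open import Data.Fin.Subset
  using (Subset; _∈_; _∉_; _⊆_; _∪_; ⁅_⁆; ∣_∣)
  renaming (⊥ to ∅; ⊤ to Full)
open import Data.Product using (Σ; ∃; ∃-syntax; _×_)
open import Relation.Nullary using (¬_; Dec)
open import Relation.Binary.PropositionalEquality using (_≡_)

record Matroid (n : ℕ) : Set₁ where
  field
    Indep       : Subset n → Set
    indep?      : (A : Subset n) → Dec (Indep A)
    indep-∅     : Indep ∅
    indep-sub   : ∀ {A B} → A ⊆ B → Indep B → Indep A
    indep-aug   : ∀ {A B} → Indep A → Indep B → ∣ A ∣ < ∣ B ∣ →
                  ∃[ x ] (x ∈ B × x ∉ A × Indep (A ∪ ⁅ x ⁆))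

module _ {n : ℕ} (M : Matroid n) where
  open Matroid M

  IsBasis : Subset n → Set
  IsBasis B = Indep B × (∀ Y → Indep Y → B ⊆ Y → Y ⊆ B)

  HasRank : Subset n → ℕ → Set
  HasRank X k = (∃[ A ] (A ⊆ X × Indep A × ∣ A ∣ ≡ k))
              × (∀ A → A ⊆ X → Indep A → ∣ A ∣ ≤ k)

  MatroidRank : ℕ → Set
  MatroidRank k = HasRank Full k

  InS : Subset n → Set
  InS A = Indep A × MatroidRank (suc ∣ A ∣)

  InK : Subset n → Fin n → Set
  InK X a = ∃[ k ] (HasRank X k × HasRank (X ∪ ⁅ a ⁆) (suc k))

  MeetsOnce : Subset n → Subset n → Set
  MeetsOnce B X = ∃[ a ] (a ∈ B × InK X a × (∀ b → b ∈ B → InK X b → b ≡ a))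

  InUnionOfBases : Subset n → Set
  InUnionOfBases B = ∀ x → x ∈ B → ∃[ B' ] (IsBasis B' × x ∈ B')

  UniqueExpansion : Set
  UniqueExpansion = ∀ B A e₁ e₂ → IsBasis B → InS A → e₁ ∈ B → e₂ ∈ B →
                    IsBasis (A ∪ ⁅ e₁ ⁆) → IsBasis (A ∪ ⁅ e₂ ⁆) → e₁ ≡ e₂

-- If B is a basis and X ∈ s(M), augmenting X from B yields some a ∈ B ∩ K(X), and every
-- b ∈ B ∩ K(X) makes X + b a basis, so unique expansion forces b = a.
-- Conversely, B is independent: if some b ∈ B lay outside a maximal independent I ⊆ B,
-- then, b being no loop (it lies in a basis), b can be exchanged into a basis B₀ ⊇ I,
-- giving a basis X + b with X ⊆ B₀; every y ∈ I outside X lies in B ∩ K(X) together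
-- with b, so I ⊆ X and I + b would be independent.  Finally an independent B is a basis:
-- otherwise B ⊆ X = B' - z for a basis B' and some z ∉ B, while K(X) is disjoint from X.
module Submission where

open import Defs
open import Data.Nat using (ℕ; suc; _<_; _≤_; s≤s; _≤?_)
open import Data.Nat.Properties using (≤-refl; ≤-antisym; 1+n≰n; ≰⇒>)
open import Data.Fin using (Fin; zero; suc)
open import Data.Fin.Subset
  using (Subset; inside; outside; _∈_; _∉_; _⊆_; _∪_; _-_; ⁅_⁆; ∣_∣; ⊤)
open import Data.Fin.Subset.Properties
open import Data.Vec as Vec using (_∷_)
open import Data.List using (List; []; _∷_; allFin)
open import Data.List.Membership.Propositional using () renaming (_∈_ to _∈ₗ_)
open import Data.List.Membership.Propositional.Properties using (∈-allFin)
open import Data.List.Relation.Unary.Any using (here; there)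
open import Data.Product using (∃-syntax; _×_; _,_; proj₁)
open import Data.Sum using (inj₁; inj₂; [_,_]′)
open import Function using (_∘_; mk⇔; _⇔_)
open import Relation.Nullary using (yes; no; contradiction)
open import Relation.Nullary.Decidable using (_×-dec_)
open import Relation.Binary.PropositionalEquality using (_≡_; refl; sym; trans; subst; cong)

module _ {n : ℕ} where

  ∪-lub : {p q r : Subset n} → p ⊆ r → q ⊆ r → p ∪ q ⊆ r
  ∪-lub {p} {q} p⊆r q⊆r x∈p∪q = [ p⊆r , q⊆r ]′ (x∈p∪q⁻ p q x∈p∪q)

  x∈p⇒⁅x⁆⊆p : {x : Fin n} {p : Subset n} → x ∈ p → ⁅ x ⁆ ⊆ p
  x∈p⇒⁅x⁆⊆p {x} {p} x∈p y∈⁅x⁆ = subst (_∈ p) (sym (x∈⁅y⁆⇒x≡y x y∈⁅x⁆)) x∈p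

  p∪⁅x⁆⊆q : {p q : Subset n} {x : Fin n} → p ⊆ q → x ∈ q → p ∪ ⁅ x ⁆ ⊆ q
  p∪⁅x⁆⊆q p⊆q x∈q = ∪-lub p⊆q (x∈p⇒⁅x⁆⊆p x∈q)

  ∪⁅x⁆-mono : {p q : Subset n} {x : Fin n} → p ⊆ q → p ∪ ⁅ x ⁆ ⊆ q ∪ ⁅ x ⁆
  ∪⁅x⁆-mono {q = q} {x} p⊆q = ∪-lub (⊆-trans p⊆q (p⊆p∪q ⁅ x ⁆)) (q⊆p∪q q ⁅ x ⁆)

  x∈p∪⁅y⁆∧x∉p⇒x≡y : {x y : Fin n} (p : Subset n) → x ∈ p ∪ ⁅ y ⁆ → x ∉ p → x ≡ y
  x∈p∪⁅y⁆∧x∉p⇒x≡y {y = y} p x∈ x∉p with x∈p∪q⁻ p ⁅ y ⁆ x∈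
  ... | inj₁ x∈p = contradiction x∈p x∉p
  ... | inj₂ x∈⁅y⁆ = x∈⁅y⁆⇒x≡y y x∈⁅y⁆

x∉p-x : ∀ {n} (p : Subset n) (x : Fin n) → x ∉ p - x
x∉p-x (s ∷ p) zero ()
x∉p-x (s ∷ p) (suc x) (Vec.there x∈p-x) = x∉p-x p x x∈p-x

∣p∪⁅x⁆∣≤1+∣p∣ : ∀ {n} (p : Subset n) (x : Fin n) → ∣ p ∪ ⁅ x ⁆ ∣ ≤ suc ∣ p ∣
∣p∪⁅x⁆∣≤1+∣p∣ (inside ∷ p) zero rewrite ∪-identityʳ p = s≤s (∣p∣≤∣x∷p∣ inside p)
∣p∪⁅x⁆∣≤1+∣p∣ (outside ∷ p) zero rewrite ∪-identityʳ p = ≤-refl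
∣p∪⁅x⁆∣≤1+∣p∣ (inside ∷ p) (suc x) = s≤s (∣p∪⁅x⁆∣≤1+∣p∣ p x)
∣p∪⁅x⁆∣≤1+∣p∣ (outside ∷ p) (suc x) = ∣p∪⁅x⁆∣≤1+∣p∣ p x

x∉p⇒∣p∪⁅x⁆∣≡1+∣p∣ : ∀ {n} {p : Subset n} {x : Fin n} → x ∉ p → ∣ p ∪ ⁅ x ⁆ ∣ ≡ suc ∣ p ∣
x∉p⇒∣p∪⁅x⁆∣≡1+∣p∣ {p = p} {x} x∉p = ≤-antisym (∣p∪⁅x⁆∣≤1+∣p∣ p x)
  (p⊂q⇒∣p∣<∣q∣ (p⊆p∪q ⁅ x ⁆ , x , q⊆p∪q p ⁅ x ⁆ (x∈⁅x⁆ x) , x∉p))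

x∈p⇒1+∣p-x∣≡∣p∣ : ∀ {n} {p : Subset n} {x : Fin n} → x ∈ p → suc ∣ p - x ∣ ≡ ∣ p ∣
x∈p⇒1+∣p-x∣≡∣p∣ {p = inside ∷ p} Vec.here = cong (suc ∘ ∣_∣) (p─⊥≡p p)
x∈p⇒1+∣p-x∣≡∣p∣ {p = inside ∷ p} (Vec.there x∈p) = cong suc (x∈p⇒1+∣p-x∣≡∣p∣ x∈p)
x∈p⇒1+∣p-x∣≡∣p∣ {p = outside ∷ p} (Vec.there x∈p) = x∈p⇒1+∣p-x∣≡∣p∣ x∈p

module _ {n : ℕ} (M : Matroid n) where
  open Matroid M

  record MaxIndepIn (S I : Subset n) : Set where
    field
      ⊆S      : I ⊆ S
      indep   : Indep I
      maximal : ∀ {x} → x ∈ S → Indep (I ∪ ⁅ x ⁆) → x ∈ I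

  open MaxIndepIn

  private
    greedy : ∀ {S J} (xs : List (Fin n)) → J ⊆ S → Indep J →
             ∃[ I ] (J ⊆ I × I ⊆ S × Indep I ×
                     (∀ {x} → x ∈ₗ xs → x ∈ S → Indep (I ∪ ⁅ x ⁆) → x ∈ I))
    greedy [] J⊆S iJ = _ , ⊆-refl , J⊆S , iJ , λ ()
    greedy {S} {J} (y ∷ ys) J⊆S iJ with (y ∈? S) ×-dec indep? (J ∪ ⁅ y ⁆)
    ... | yes (y∈S , iJy) with greedy ys (p∪⁅x⁆⊆q J⊆S y∈S) iJy
    ...   | I , Jy⊆I , I⊆S , iI , maxI =
      I , ⊆-trans (p⊆p∪q ⁅ y ⁆) Jy⊆I , I⊆S , iI ,
      λ { (here refl) _ _ → Jy⊆I (q⊆p∪q J ⁅ y ⁆ (x∈⁅x⁆ y)) ; (there x∈ys) → maxI x∈ys }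
    greedy {S} {J} (y ∷ ys) J⊆S iJ | no ¬y∈S×iJy with greedy ys J⊆S iJ
    ...   | I , J⊆I , I⊆S , iI , maxI =
      I , J⊆I , I⊆S , iI ,
      λ { (here refl) y∈S iIy → contradiction (y∈S , indep-sub (∪⁅x⁆-mono J⊆I) iIy) ¬y∈S×iJy
        ; (there x∈ys) → maxI x∈ys }

  extend : ∀ {S J} → J ⊆ S → Indep J → ∃[ I ] (J ⊆ I × MaxIndepIn S I)
  extend J⊆S iJ with greedy (allFin _) J⊆S iJ
  ... | I , J⊆I , I⊆S , iI , maxI =
    I , J⊆I , record { ⊆S = I⊆S ; indep = iI ; maximal = maxI (∈-allFin _) }

  maxIndep-largest : ∀ {S I J} → MaxIndepIn S I → J ⊆ S → Indep J → ∣ J ∣ ≤ ∣ I ∣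
  maxIndep-largest {I = I} {J} m J⊆S iJ with ∣ J ∣ ≤? ∣ I ∣
  ... | yes ∣J∣≤∣I∣ = ∣J∣≤∣I∣
  ... | no ∣J∣≰∣I∣ with indep-aug (indep m) iJ (≰⇒> ∣J∣≰∣I∣)
  ...   | x , x∈J , x∉I , iIx = contradiction (maximal m (J⊆S x∈J) iIx) x∉I

  maxIndep-hasRank : ∀ {S I} → MaxIndepIn S I → HasRank M S ∣ I ∣
  maxIndep-hasRank m = (_ , ⊆S m , indep m , refl) , λ _ → maxIndep-largest m

  indep-hasRank : ∀ {X} → Indep X → HasRank M X ∣ X ∣
  indep-hasRank iX =
    maxIndep-hasRank record { ⊆S = ⊆-refl ; indep = iX ; maximal = λ x∈X _ → x∈X }

  hasRank-unique : ∀ {X k l} → HasRank M X k → HasRank M X l → k ≡ l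
  hasRank-unique ((A , A⊆X , iA , refl) , bound-k) ((C , C⊆X , iC , refl) , bound-l) =
    ≤-antisym (bound-l A A⊆X iA) (bound-k C C⊆X iC)

  basis⇒maxIndep : ∀ {B} → IsBasis M B → MaxIndepIn ⊤ B
  basis⇒maxIndep {B} (iB , maxB) = record
    { ⊆S = ⊆⊤ ; indep = iB
    ; maximal = λ {x} _ iBx → maxB _ iBx (p⊆p∪q ⁅ x ⁆) (q⊆p∪q B ⁅ x ⁆ (x∈⁅x⁆ x)) }

  maxIndep⇒basis : ∀ {B} → MaxIndepIn ⊤ B → IsBasis M B
  maxIndep⇒basis m = indep m , λ Y iY B⊆Y y∈Y → maximal m ∈⊤ (indep-sub (p∪⁅x⁆⊆q B⊆Y y∈Y) iY)

  basis-size : ∀ {B r} → IsBasis M B → MatroidRank M r → ∣ B ∣ ≡ r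
  basis-size bB = hasRank-unique (maxIndep-hasRank (basis⇒maxIndep bB))

  indep-rank⇒basis : ∀ {B} → Indep B → MatroidRank M ∣ B ∣ → IsBasis M B
  indep-rank⇒basis {B} iB (_ , bound) = maxIndep⇒basis record
    { ⊆S = ⊆⊤ ; indep = iB ; maximal = maximal′ }
    where
    maximal′ : ∀ {x} → x ∈ ⊤ → Indep (B ∪ ⁅ x ⁆) → x ∈ B
    maximal′ {x} _ iBx with x ∈? B
    ... | yes x∈B = x∈B
    ... | no x∉B = contradiction (subst (_≤ ∣ B ∣) (x∉p⇒∣p∪⁅x⁆∣≡1+∣p∣ x∉B) (bound _ ⊆⊤ iBx)) 1+n≰n

  indep-rank⇒inS : ∀ {B x} → Indep B → MatroidRank M ∣ B ∣ → x ∈ B → InS M (B - x)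
  indep-rank⇒inS {B} {x} iB R x∈B =
    indep-sub (p─q⊆p B ⁅ x ⁆) iB , subst (MatroidRank M) (sym (x∈p⇒1+∣p-x∣≡∣p∣ x∈B)) R

  inS-augment⇒basis : ∀ {X a} → InS M X → Indep (X ∪ ⁅ a ⁆) → a ∉ X → IsBasis M (X ∪ ⁅ a ⁆)
  inS-augment⇒basis (_ , R) iXa a∉X =
    indep-rank⇒basis iXa (subst (MatroidRank M) (sym (x∉p⇒∣p∪⁅x⁆∣≡1+∣p∣ a∉X)) R)

  InK⇒∉ : ∀ {X a} → InK M X a → a ∉ X
  InK⇒∉ (k , (_ , bound) , ((A , A⊆Xa , iA , ∣A∣≡1+k) , _)) a∈X =
    1+n≰n (subst (_≤ k) ∣A∣≡1+k (bound A (⊆-trans A⊆Xa (p∪⁅x⁆⊆q ⊆-refl a∈X)) iA))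

  InK⇒augments : ∀ {X a} → Indep X → InK M X a → Indep (X ∪ ⁅ a ⁆)
  InK⇒augments {X} iX (k , (_ , bound) , ((A , A⊆Xa , iA , ∣A∣≡1+k) , _))
    with indep-aug iX iA (subst (∣ X ∣ <_) (sym ∣A∣≡1+k) (s≤s (bound X ⊆-refl iX)))
  ... | x , x∈A , x∉X , iXx =
    subst (λ z → Indep (X ∪ ⁅ z ⁆)) (x∈p∪⁅y⁆∧x∉p⇒x≡y X (A⊆Xa x∈A) x∉X) iXx

  augments⇒InK : ∀ {X a} → Indep (X ∪ ⁅ a ⁆) → a ∉ X → InK M X a
  augments⇒InK {X} iXa a∉X =
    ∣ X ∣ , indep-hasRank (indep-sub (p⊆p∪q _) iXa) ,
    subst (HasRank M _) (x∉p⇒∣p∪⁅x⁆∣≡1+∣p∣ a∉X) (indep-hasRank iXa)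

  meetsOnce-unique : ∀ {B X a b} → MeetsOnce M B X →
                     a ∈ B → InK M X a → b ∈ B → InK M X b → a ≡ b
  meetsOnce-unique (_ , _ , _ , only) a∈B ka b∈B kb = trans (only _ a∈B ka) (sym (only _ b∈B kb))

  basis⇒meetsOnce : UniqueExpansion M → ∀ {B X} → IsBasis M B → InS M X → MeetsOnce M B X
  basis⇒meetsOnce UE {B} {X} bB sX@(iX , R)
    with indep-aug iX (proj₁ bB) (subst (∣ X ∣ <_) (sym (basis-size bB R)) ≤-refl)
  ... | a , a∈B , a∉X , iXa =
    a , a∈B , augments⇒InK iXa a∉X ,
    λ b b∈B kb → UE B X b a bB sX b∈B a∈B
                   (inS-augment⇒basis sX (InK⇒augments iX kb) (InK⇒∉ kb))
                   (inS-augment⇒basis sX iXa a∉X)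

  nonloop-exchange : ∀ {B₀ b} → MaxIndepIn ⊤ B₀ → Indep ⁅ b ⁆ →
                     ∃[ X ] (X ⊆ B₀ × InS M X × Indep (X ∪ ⁅ b ⁆))
  nonloop-exchange {B₀} {b} m₀ ib with extend (q⊆p∪q B₀ ⁅ b ⁆) ib
  ... | B₁ , b⊆B₁ , m₁ =
    B₁ - b , X⊆B₀ , indep-rank⇒inS (indep m₁) R₁ b∈B₁ ,
    indep-sub (p∪⁅x⁆⊆q (p─q⊆p B₁ ⁅ b ⁆) b∈B₁) (indep m₁)
    where
    b∈B₁ : b ∈ B₁
    b∈B₁ = b⊆B₁ (x∈⁅x⁆ b)
    R₁ : MatroidRank M ∣ B₁ ∣
    R₁ = subst (MatroidRank M)
           (≤-antisym (maxIndep-largest m₁ (p⊆p∪q ⁅ b ⁆) (indep m₀))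
                      (maxIndep-largest m₀ ⊆⊤ (indep m₁)))
           (maxIndep-hasRank m₀)
    X⊆B₀ : B₁ - b ⊆ B₀
    X⊆B₀ {y} y∈X =
      [ (λ y∈B₀ → y∈B₀)
      , (λ y∈⁅b⁆ → contradiction (subst (_∈ B₁ - b) (x∈⁅y⁆⇒x≡y b y∈⁅b⁆) y∈X) (x∉p-x B₁ b))
      ]′ (x∈p∪q⁻ B₀ ⁅ b ⁆ (⊆S m₁ (p─q⊆p B₁ ⁅ b ⁆ y∈X)))

  nonloop∈maxIndepIn : ∀ {B I b} → (∀ X → InS M X → MeetsOnce M B X) →
                    MaxIndepIn B I → b ∈ B → Indep ⁅ b ⁆ → b ∈ I
  nonloop∈maxIndepIn {B} {I} {b} meets m b∈B ib with b ∈? I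
  ... | yes b∈I = b∈I
  ... | no b∉I with extend ⊆⊤ (indep m)
  ...   | B₀ , I⊆B₀ , m₀ with nonloop-exchange m₀ ib
  ...     | X , X⊆B₀ , sX , iXb =
    contradiction (maximal m b∈B (indep-sub (∪⁅x⁆-mono I⊆X) iXb)) b∉I
    where
    b∉X : b ∉ X
    b∉X b∈X = b∉I (maximal m b∈B (indep-sub (p∪⁅x⁆⊆q I⊆B₀ (X⊆B₀ b∈X)) (indep m₀)))
    I⊆X : I ⊆ X
    I⊆X {y} y∈I with y ∈? X
    ... | yes y∈X = y∈X
    ... | no y∉X = contradiction (subst (_∈ I) y≡b y∈I) b∉I
      where
      y≡b : y ≡ b
      y≡b = meetsOnce-unique (meets X sX)
              (⊆S m y∈I) (augments⇒InK (indep-sub (p∪⁅x⁆⊆q X⊆B₀ (I⊆B₀ y∈I)) (indep m₀)) y∉X)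
              b∈B (augments⇒InK iXb b∉X)

  meetsOnce⇒indep : ∀ {B} → InUnionOfBases M B → (∀ X → InS M X → MeetsOnce M B X) → Indep B
  meetsOnce⇒indep {B} B⊆⋃ meets with extend (⊆-min B) indep-∅
  ... | I , _ , m = indep-sub (λ b∈B → nonloop∈maxIndepIn meets m b∈B (nonloop (B⊆⋃ _ b∈B))) (indep m)
    where
    nonloop : ∀ {b} → ∃[ B′ ] (IsBasis M B′ × b ∈ B′) → Indep ⁅ b ⁆
    nonloop (B′ , (iB′ , _) , b∈B′) = indep-sub (x∈p⇒⁅x⁆⊆p b∈B′) iB′

  indep-meetsOnce⇒basis : ∀ {B} → Indep B → (∀ X → InS M X → MeetsOnce M B X) → IsBasis M B
  indep-meetsOnce⇒basis {B} iB meets with extend ⊆⊤ iB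
  ... | B₂ , B⊆B₂ , m₂ = subst (IsBasis M) (⊆-antisym B₂⊆B B⊆B₂) (maxIndep⇒basis m₂)
    where
    B₂⊆B : B₂ ⊆ B
    B₂⊆B {z} z∈B₂ with z ∈? B
    ... | yes z∈B = z∈B
    ... | no z∉B with meets (B₂ - z) (indep-rank⇒inS (indep m₂) (maxIndep-hasRank m₂) z∈B₂)
    ...   | a , a∈B , ka , _ =
      contradiction (x∈p∧x≢y⇒x∈p-y (B⊆B₂ a∈B) (λ a≡z → z∉B (subst (_∈ B) a≡z a∈B))) (InK⇒∉ ka)

proposition7 : ∀ {n} (M : Matroid n) → UniqueExpansion M →
    (∀ k → MatroidRank M k → 0 < k) →
    (B : Subset n) →
    IsBasis M B ⇔ (InUnionOfBases M B × (∀ X → InS M X → MeetsOnce M B X))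
proposition7 M UE _ B = mk⇔
  (λ bB → (λ _ b∈B → B , bB , b∈B) , λ X → basis⇒meetsOnce M UE bB)
  (λ (B⊆⋃ , meets) → indep-meetsOnce⇒basis M (meetsOnce⇒indep M B⊆⋃ meets) meets)
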